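{- Let $G$ and $H$ be connected, circulant, bipartite graphs on $2n$ and $2m$ vertices respectively. If $\gcd(n,m)=1$, then $G\otimes H$ is a circulant graph.
   Context: The tensor product $G\otimes H$ has vertex set $V(G)\times V(H)$, with $(g,h)$ adjacent to $(g',h')$ iff $g$ is adjacent to $g'$ in $G$ and $h$ is adjacent to $h'$ in $H$. A graph on $N$ vertices is circulant if its vertices can be labeled by $\mathbb{Z}_N$ so that, for some set $S\subseteq\mathbb{Z}_N$ with $S=-S$, vertices $i$ and $j$ are adjacent iff $j-i\in S\pmod N$. -}

module Defs where

open import Data.Nat using (ℕ; suc; _+_; _∸_)
open import Data.Nat.DivMod using (_mod_)
open import Data.Fin using (Fin; toℕ)
open import Data.Bool using (Bool)
open import Data.Product using (Σ; _×_; _,_)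
open import Function.Bundles using (_↔_; _⇔_)
open import Relation.Binary.PropositionalEquality using (_≡_; _≢_)
open import Relation.Nullary using (¬_)

record Graph : Set₁ where
  field
    V      : Set
    Adj    : V → V → Set
    sym    : ∀ {u v} → Adj u v → Adj v u
    irrefl : ∀ {v} → ¬ Adj v v
open Graph public

HasOrder : Graph → ℕ → Set
HasOrder G N = V G ↔ Fin N

data Walk (G : Graph) : V G → V G → Set where
  [] : ∀ {v} → Walk G v v
  _∷_ : ∀ {u v w} → Adj G u v → Walk G v w → Walk G u w

Connected : Graph → Set
Connected G = ∀ u v → Walk G u v

Bipartite : Graph → Set
Bipartite G = Σ (V G → Bool) λ c → ∀ {u v} → Adj G u v → c u ≢ c v

negℤ : ∀ {N} → Fin N → Fin N
negℤ {suc k} a = (suc k ∸ toℕ a) mod (suc k)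

subℤ : ∀ {N} → Fin N → Fin N → Fin N
subℤ {suc k} j i = (toℕ j + (suc k ∸ toℕ i)) mod (suc k)

IsCirculant : Graph → Set₁
IsCirculant G =
  Σ ℕ λ N → Σ (V G ↔ Fin N) λ f → Σ (Fin N → Set) λ S →
    (∀ x → S x → S (negℤ x)) ×
    (∀ u v → Adj G u v ⇔ S (subℤ (Inverse.to f v) (Inverse.to f u)))
  where open import Function.Bundles using (Inverse)

_⊗_ : Graph → Graph → Graph
G ⊗ H = record
  { V = V G × V H
  ; Adj = λ { (g , h) (g' , h') → Adj G g g' × Adj H h h' }
  ; sym = λ { (a , b) → sym G a , sym H b }
  ; irrefl = λ { (a , b) → irrefl G a }
  }

-- In a connected bipartite circulant graph on ℤ_N, read the 2-colouring on labels. Translating one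
-- walk from 0 to 1 shows that every unit step changes the colour by the same bit, so every even
-- step preserves it: all elements of the connection set are odd.
--
-- Hence G ⊗ H is the Cayley graph of ℤ_{2n} × ℤ_{2m} with connection set S × T, which lies in the
-- subgroup generated by (1, 1). For gcd (n, m) = 1 that subgroup is cyclic of order 2nm and has
-- index 2, so  e + 2y ↦ (y, y + e)  (e ∈ {0, 1}) identifies ℤ_{4nm} with ℤ_{2n} × ℤ_{2m} and turns
-- G ⊗ H into the circulant on ℤ_{4nm} with connection set {2h ∣ h mod 2n ∈ S, h mod 2m ∈ T}.
module Submission where

open import Data.Bool using (Bool; false; not; _xor_)
open import Data.Bool.Properties
  using (¬-not; xor-assoc; xor-same; xor-identityʳ; not-distribˡ-xor; not-distribʳ-xor)
open import Data.Empty using (⊥; ⊥-elim)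
open import Data.Fin using (Fin; toℕ; punchOut)
import Data.Fin.Properties as Fin
open import Data.Fin.Permutation using (↔⇒≡)
open import Data.Integer as ℤ using (ℤ; +_; _+_; _-_; -_)
import Data.Integer.Properties as ℤ
open import Data.Integer.Divisibility.Signed
  using (_∣_; divides; ∣ᵤ⇒∣; ∣⇒∣ᵤ; ∣-trans; ∣m∣n⇒∣m+n; ∣m⇒∣-m; *-cancelˡ-∣)
open import Data.Integer.Tactic.RingSolver using (solve-∀)
open import Data.Nat as ℕ using (ℕ; zero; suc; _*_; _∸_; _<_; NonZero)
import Data.Nat.Properties as ℕ
open import Data.Nat.Divisibility as ℕ using (divides; >⇒∤)
open import Data.Nat.DivMod using (_mod_; _%_; _/_; m≡m%n+[m/n]*n; m%n<n; m<n*o⇒m/o<n)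
open import Data.Nat.GCD using (gcd; c*gcd[m,n]≡gcd[cm,cn])
open import Data.Nat.LCM using (lcm; lcm-least; gcd*lcm)
import Data.Nat.Tactic.RingSolver as ℕ-Solver
open import Data.Product using (∃; _×_; _,_; proj₁; proj₂)
open import Data.Product.Function.NonDependent.Propositional using (_×-↔_; _×-⇔_)
open import Data.Sum using (_⊎_; inj₁; inj₂)
open import Function using (_∘_)
open import Function.Bundles using (_↔_; _⇔_; Inverse; Equivalence; mk⇔; mk↔ₛ′)
open import Function.Construct.Composition using (_↔-∘_; _⇔-∘_)
open import Function.Construct.Identity using (⇔-id)
open import Function.Construct.Symmetry using (↔-sym)
open import Function.Definitions using (Injective)
open import Level using (0ℓ)
open import Relation.Binary.Bundles using (Setoid)
open import Relation.Binary.Structures using (IsEquivalence)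
import Relation.Binary.PropositionalEquality as ≡
open ≡ using (_≡_; _≢_; refl; trans; cong; cong₂; subst; subst₂; module ≡-Reasoning)
open import Relation.Nullary using (contradiction; yes; no)

open import Defs

-- Congruence modulo N

-- A record rather than a synonym for  + N ∣ a - b , so that a, b and N stay inferable.
infix 4 _≡_[mod_]
record _≡_[mod_] (a b : ℤ) (N : ℕ) : Set where
  constructor mk≡mod
  field
    divides-difference : + N ∣ a - b

module _ {N : ℕ} where

  ≡mod-reflexive : ∀ {a b} → a ≡ b → a ≡ b [mod N ]
  ≡mod-reflexive {a} refl = mk≡mod (divides (+ 0) (ℤ.+-inverseʳ a))

  ≡mod-refl : ∀ {a} → a ≡ a [mod N ]
  ≡mod-refl = ≡mod-reflexive refl

  ≡mod-sym : ∀ {a b} → a ≡ b [mod N ] → b ≡ a [mod N ]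
  ≡mod-sym {a} {b} (mk≡mod p) = mk≡mod (subst (+ N ∣_) (negate a b) (∣m⇒∣-m p))
    where
    negate : ∀ a b → - (a - b) ≡ b - a
    negate = solve-∀

  ≡mod-trans : ∀ {a b c} → a ≡ b [mod N ] → b ≡ c [mod N ] → a ≡ c [mod N ]
  ≡mod-trans {a} {b} {c} (mk≡mod p) (mk≡mod q) =
    mk≡mod (subst (+ N ∣_) (telescope a b c) (∣m∣n⇒∣m+n p q))
    where
    telescope : ∀ a b c → (a - b) + (b - c) ≡ a - c
    telescope = solve-∀

  ≡mod-isEquivalence : IsEquivalence (λ a b → a ≡ b [mod N ])
  ≡mod-isEquivalence = record { refl = ≡mod-refl ; sym = ≡mod-sym ; trans = ≡mod-trans }

  ≡mod-+ : ∀ {a b c d} → a ≡ b [mod N ] → c ≡ d [mod N ] → a + c ≡ b + d [mod N ]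
  ≡mod-+ {a} {b} {c} {d} (mk≡mod p) (mk≡mod q) =
    mk≡mod (subst (+ N ∣_) (interchange a b c d) (∣m∣n⇒∣m+n p q))
    where
    interchange : ∀ a b c d → (a - b) + (c - d) ≡ (a + c) - (b + d)
    interchange = solve-∀

  ≡mod-neg : ∀ {a b} → a ≡ b [mod N ] → - a ≡ - b [mod N ]
  ≡mod-neg {a} {b} (mk≡mod p) = mk≡mod (subst (+ N ∣_) (negate a b) (∣m⇒∣-m p))
    where
    negate : ∀ a b → - (a - b) ≡ - a - - b
    negate = solve-∀

  ≡mod-- : ∀ {a b c d} → a ≡ b [mod N ] → c ≡ d [mod N ] → a - c ≡ b - d [mod N ]
  ≡mod-- p q = ≡mod-+ p (≡mod-neg q)

  ≡mod-multiple : ∀ {a} k → a + k ℤ.* + N ≡ a [mod N ]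
  ≡mod-multiple {a} k = mk≡mod (divides k (cancel a k (+ N)))
    where
    cancel : ∀ a k n → (a + k ℤ.* n) - a ≡ k ℤ.* n
    cancel = solve-∀

  multiple≡mod0 : ∀ k → k ℤ.* + N ≡ + 0 [mod N ]
  multiple≡mod0 k =
    ≡mod-trans (≡mod-reflexive (≡.sym (ℤ.+-identityˡ (k ℤ.* + N)))) (≡mod-multiple k)

  ≡mod-+-cancelʳ : ∀ {a b c d} → a + c ≡ b + d [mod N ] → c ≡ d [mod N ] → a ≡ b [mod N ]
  ≡mod-+-cancelʳ {a} {b} {c} {d} a+c≡b+d c≡d =
    ≡mod-trans (≡mod-reflexive (restore a c))
      (≡mod-trans (≡mod-- a+c≡b+d c≡d) (≡mod-reflexive (≡.sym (restore b d))))
    where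
    restore : ∀ a c → a ≡ (a + c) - c
    restore = solve-∀

  ≡mod-+-cancelˡ : ∀ {a b c d} → a + c ≡ b + d [mod N ] → a ≡ b [mod N ] → c ≡ d [mod N ]
  ≡mod-+-cancelˡ {a} {b} {c} {d} a+c≡b+d =
    ≡mod-+-cancelʳ (subst₂ (λ s t → s ≡ t [mod N ]) (ℤ.+-comm a c) (ℤ.+-comm b d) a+c≡b+d)

  ≡mod-from-difference : ∀ {a b} → a - b ≡ + 0 [mod N ] → a ≡ b [mod N ]
  ≡mod-from-difference {a} {b} a-b≡0 =
    subst₂ (λ s t → s ≡ t [mod N ]) (restore a b) (ℤ.+-identityˡ b)
           (≡mod-+ a-b≡0 (≡mod-refl {a = b}))
    where
    restore : ∀ a b → (a - b) + b ≡ a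
    restore = solve-∀

≡mod-setoid : ℕ → Setoid 0ℓ 0ℓ
≡mod-setoid N = record { isEquivalence = ≡mod-isEquivalence {N} }

module ≡mod-Reasoning (N : ℕ) where
  open import Relation.Binary.Reasoning.Setoid (≡mod-setoid N) public

≡mod-∣ : ∀ {M N a b} → M ℕ.∣ N → a ≡ b [mod N ] → a ≡ b [mod M ]
≡mod-∣ M∣N (mk≡mod p) = mk≡mod (∣-trans (∣ᵤ⇒∣ M∣N) p)

≡mod-lcm : ∀ {M N a b} → a ≡ b [mod M ] → a ≡ b [mod N ] → a ≡ b [mod lcm M N ]
≡mod-lcm (mk≡mod p) (mk≡mod q) = mk≡mod (∣ᵤ⇒∣ (lcm-least (∣⇒∣ᵤ p) (∣⇒∣ᵤ q)))

≡mod-*-cancelˡ : ∀ c {N a b} .{{_ : NonZero c}} →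
                 + c ℤ.* a ≡ + c ℤ.* b [mod c * N ] → a ≡ b [mod N ]
≡mod-*-cancelˡ c {N} {a} {b} (mk≡mod p) =
  mk≡mod (*-cancelˡ-∣ (+ c) (subst₂ _∣_ (ℤ.pos-* c N) (distrib (+ c) a b) p))
  where
  distrib : ∀ c a b → c ℤ.* a - c ℤ.* b ≡ c ℤ.* (a - b)
  distrib = solve-∀

multiple-below⇒≡0 : ∀ {N} d → N ℕ.∣ d → d < N → d ≡ 0
multiple-below⇒≡0 zero    _   _   = refl
multiple-below⇒≡0 (suc d) N∣d d<N = contradiction N∣d (>⇒∤ d<N)

≡mod⇒≡ : ∀ {N p q} → p < N → q < N → + p ≡ + q [mod N ] → p ≡ q
≡mod⇒≡ {N} {p} {q} p<N q<N (mk≡mod N∣p-q) =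
  ℤ.+-injective (ℤ.i-j≡0⇒i≡j (+ p) (+ q) (ℤ.∣i∣≡0⇒i≡0
    (multiple-below⇒≡0 ℤ.∣ + p - + q ∣ (∣⇒∣ᵤ N∣p-q) ∣p-q∣<N)))
  where
  ∣p-q∣<N : ℤ.∣ + p - + q ∣ < N
  ∣p-q∣<N = subst (_< N) (cong ℤ.∣_∣ (≡.sym (ℤ.m-n≡m⊖n p q)))
                  (ℕ.≤-<-trans (ℤ.∣m⊝n∣≤m⊔n p q) (ℕ.⊔-pres-<m p<N q<N))

even-or-odd : ∀ k → (∃ λ j → k ≡ 2 * j) ⊎ (+ k ≡ + 1 [mod 2 ])
even-or-odd zero          = inj₁ (0 , refl)
even-or-odd (suc zero)    = inj₂ ≡mod-refl
even-or-odd (suc (suc k)) with even-or-odd k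
... | inj₁ (j , refl) = inj₁ (suc j , ≡.sym (ℕ.*-suc 2 j))
... | inj₂ k-odd      =
  inj₂ (≡mod-trans (≡mod-reflexive 2+k≡k+1*2) (≡mod-trans (≡mod-multiple (+ 1)) k-odd))
  where
  2+k≡k+1*2 : + suc (suc k) ≡ + k + + 1 ℤ.* + 2
  2+k≡k+1*2 = trans (cong +_ (ℕ.+-comm 2 k)) (ℤ.pos-+ k 2)

-- Residues

toℤ : ∀ {N} → Fin N → ℤ
toℤ i = + toℕ i

OddConnectionSet : ∀ {N} → (Fin N → Set) → Set
OddConnectionSet S = ∀ s → S s → toℤ s ≡ + 1 [mod 2 ]

toℤ-mod : ∀ N .{{_ : NonZero N}} x → toℤ (x mod N) ≡ + x [mod N ]
toℤ-mod N x = begin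
  toℤ (x mod N)                    ≡⟨ cong +_ (Fin.toℕ-fromℕ< (m%n<n x N)) ⟩
  + (x % N)                        ≈⟨ ≡mod-multiple (+ (x / N)) ⟨
  + (x % N) + + (x / N) ℤ.* + N    ≡⟨ cong (λ t → + (x % N) + t) (ℤ.pos-* (x / N) N) ⟨
  + (x % N) + + (x / N * N)        ≡⟨ ℤ.pos-+ (x % N) (x / N * N) ⟨
  + (x % N ℕ.+ x / N * N)          ≡⟨ cong +_ (m≡m%n+[m/n]*n x N) ⟨
  + x                              ∎
  where open ≡mod-Reasoning N

toℤ-injective : ∀ {N} {i j : Fin N} → toℤ i ≡ toℤ j [mod N ] → i ≡ j
toℤ-injective {i = i} {j} = Fin.toℕ-injective ∘ ≡mod⇒≡ (Fin.toℕ<n i) (Fin.toℕ<n j)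

toℤ-∸ : ∀ {N} (i : Fin N) → + (N ∸ toℕ i) ≡ + N - toℤ i
toℤ-∸ {N} i = ≡.sym (trans (ℤ.m-n≡m⊖n N (toℕ i)) (ℤ.⊖-≥ (ℕ.<⇒≤ (Fin.toℕ<n i))))

toℤ-subℤ : ∀ {N} (j i : Fin N) → toℤ (subℤ j i) ≡ toℤ j - toℤ i [mod N ]
toℤ-subℤ {N@(suc _)} j i = begin
  toℤ (subℤ j i)                      ≈⟨ toℤ-mod N (toℕ j ℕ.+ (N ∸ toℕ i)) ⟩
  + (toℕ j ℕ.+ (N ∸ toℕ i))           ≡⟨ ℤ.pos-+ (toℕ j) (N ∸ toℕ i) ⟩
  toℤ j + + (N ∸ toℕ i)               ≡⟨ cong (λ t → toℤ j + t) (toℤ-∸ i) ⟩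
  toℤ j + (+ N - toℤ i)               ≡⟨ rearrange (toℤ j) (toℤ i) (+ N) ⟩
  (toℤ j - toℤ i) + + 1 ℤ.* + N       ≈⟨ ≡mod-multiple (+ 1) ⟩
  toℤ j - toℤ i                       ∎
  where
  open ≡mod-Reasoning N
  rearrange : ∀ a b n → a + (n - b) ≡ (a - b) + + 1 ℤ.* n
  rearrange = solve-∀

toℤ-negℤ : ∀ {N} (i : Fin N) → toℤ (negℤ i) ≡ - toℤ i [mod N ]
toℤ-negℤ {N@(suc _)} i = begin
  toℤ (negℤ i)                  ≈⟨ toℤ-mod N (N ∸ toℕ i) ⟩
  + (N ∸ toℕ i)                 ≡⟨ toℤ-∸ i ⟩
  + N - toℤ i                   ≡⟨ rearrange (toℤ i) (+ N) ⟩
  - toℤ i + + 1 ℤ.* + N         ≈⟨ ≡mod-multiple (+ 1) ⟩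
  - toℤ i                       ∎
  where
  open ≡mod-Reasoning N
  rearrange : ∀ a n → n - a ≡ - a + + 1 ℤ.* n
  rearrange = solve-∀

subℤ-subℤ-self : ∀ {N} (d : Fin N) → subℤ d (subℤ d d) ≡ d
subℤ-subℤ-self {N} d = toℤ-injective (begin
  toℤ (subℤ d (subℤ d d))       ≈⟨ toℤ-subℤ d (subℤ d d) ⟩
  toℤ d - toℤ (subℤ d d)        ≈⟨ ≡mod-- (≡mod-refl {a = toℤ d}) (toℤ-subℤ d d) ⟩
  toℤ d - (toℤ d - toℤ d)       ≡⟨ cancel (toℤ d) ⟩
  toℤ d                         ∎)
  where
  open ≡mod-Reasoning N
  cancel : ∀ a → a - (a - a) ≡ a
  cancel = solve-∀

subℤ-self-subℤ : ∀ {N} (d : Fin N) → subℤ (subℤ d d) d ≡ negℤ d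
subℤ-self-subℤ {N} d = toℤ-injective (begin
  toℤ (subℤ (subℤ d d) d)       ≈⟨ toℤ-subℤ (subℤ d d) d ⟩
  toℤ (subℤ d d) - toℤ d        ≈⟨ ≡mod-- (toℤ-subℤ d d) (≡mod-refl {a = toℤ d}) ⟩
  (toℤ d - toℤ d) - toℤ d       ≡⟨ cancel (toℤ d) ⟩
  - toℤ d                       ≈⟨ toℤ-negℤ d ⟨
  toℤ (negℤ d)                  ∎)
  where
  open ≡mod-Reasoning N
  cancel : ∀ a → (a - a) - a ≡ - a
  cancel = solve-∀

translate : ∀ {N} .{{_ : NonZero N}} → ℕ → Fin N → Fin N
translate {N} t i = (toℕ i ℕ.+ t) mod N

module _ {N : ℕ} .{{_ : NonZero N}} where
  open ≡mod-Reasoning N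

  toℤ-translate : ∀ t (i : Fin N) → toℤ (translate t i) ≡ toℤ i + + t [mod N ]
  toℤ-translate t i = ≡mod-trans (toℤ-mod N (toℕ i ℕ.+ t)) (≡mod-reflexive (ℤ.pos-+ (toℕ i) t))

  translate-≡ : ∀ t {i j : Fin N} → toℤ i + + t ≡ toℤ j [mod N ] → translate t i ≡ j
  translate-≡ t {i} i+t≡j = toℤ-injective (≡mod-trans (toℤ-translate t i) i+t≡j)

  translate-+ : ∀ s t (i : Fin N) → translate s (translate t i) ≡ translate (t ℕ.+ s) i
  translate-+ s t i = translate-≡ s (begin
    toℤ (translate t i) + + s      ≈⟨ ≡mod-+ (toℤ-translate t i) (≡mod-refl {a = + s}) ⟩
    (toℤ i + + t) + + s            ≡⟨ ℤ.+-assoc (toℤ i) (+ t) (+ s) ⟩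
    toℤ i + (+ t + + s)            ≡⟨ cong (λ k → toℤ i + k) (ℤ.pos-+ t s) ⟨
    toℤ i + + (t ℕ.+ s)            ≈⟨ toℤ-translate (t ℕ.+ s) i ⟨
    toℤ (translate (t ℕ.+ s) i)    ∎)

  translate-comm : ∀ s t (i : Fin N) → translate s (translate t i) ≡ translate t (translate s i)
  translate-comm s t i =
    trans (translate-+ s t i)
          (trans (cong (λ k → translate k i) (ℕ.+-comm t s)) (≡.sym (translate-+ t s i)))

  translate-origin : ∀ (i : Fin N) → translate (toℕ i) (0 mod N) ≡ i
  translate-origin i = translate-≡ (toℕ i) (≡mod-+ (toℤ-mod N 0) (≡mod-refl {a = toℤ i}))

  subℤ-translate : ∀ t (i j : Fin N) → subℤ (translate t j) (translate t i) ≡ subℤ j i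
  subℤ-translate t i j = toℤ-injective (begin
    toℤ (subℤ (translate t j) (translate t i))      ≈⟨ toℤ-subℤ (translate t j) (translate t i) ⟩
    toℤ (translate t j) - toℤ (translate t i)
      ≈⟨ ≡mod-- (toℤ-translate t j) (toℤ-translate t i) ⟩
    (toℤ j + + t) - (toℤ i + + t)                   ≡⟨ cancel (toℤ j) (toℤ i) (+ t) ⟩
    toℤ j - toℤ i                                   ≈⟨ toℤ-subℤ j i ⟨
    toℤ (subℤ j i)                                  ∎)
    where
    cancel : ∀ a b c → (a + c) - (b + c) ≡ a - b
    cancel = solve-∀

  subℤ-translate-self : ∀ (t i : Fin N) → subℤ (translate (toℕ t) i) i ≡ t
  subℤ-translate-self t i = toℤ-injective (begin
    toℤ (subℤ (translate (toℕ t) i) i)      ≈⟨ toℤ-subℤ (translate (toℕ t) i) i ⟩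
    toℤ (translate (toℕ t) i) - toℤ i
      ≈⟨ ≡mod-- (toℤ-translate (toℕ t) i) (≡mod-refl {a = toℤ i}) ⟩
    (toℤ i + toℤ t) - toℤ i                 ≡⟨ cancel (toℤ i) (toℤ t) ⟩
    toℤ t                                   ∎)
    where
    cancel : ∀ a b → (a + b) - a ≡ b
    cancel = solve-∀

fin-injective⇒surjective : ∀ {k} (g : Fin k → Fin k) → Injective _≡_ _≡_ g →
                           ∀ y → ∃ λ x → g x ≡ y
fin-injective⇒surjective {suc k} g g-injective y with Fin.any? (λ x → g x Fin.≟ y)
... | yes hit = hit
... | no miss = contradiction (Fin.injective⇒≤ punched-injective) (ℕ.<-irrefl refl)
  where
  y≢g : ∀ x → y ≢ g x
  y≢g x y≡gx = miss (x , ≡.sym y≡gx)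
  punched-injective : Injective _≡_ _≡_ (λ x → punchOut (y≢g x))
  punched-injective = g-injective ∘ Fin.punchOut-injective (y≢g _) (y≢g _)

injective⇒↔ : ∀ {k} {X : Set} (f : Fin k → X) → Injective _≡_ _≡_ f →
              X ↔ Fin k → Fin k ↔ X
injective⇒↔ {k} {X} f f-injective e =
  mk↔ₛ′ f f⁻¹ f∘f⁻¹ (λ x → f-injective (f∘f⁻¹ (f x)))
  where
  open Inverse e using (to; from; strictlyInverseʳ)
  to-injective : Injective _≡_ _≡_ to
  to-injective {a} {b} eq = trans (≡.sym (strictlyInverseʳ a)) (trans (cong from eq) (strictlyInverseʳ b))
  preimage : ∀ y → ∃ λ x → to (f x) ≡ to y
  preimage y = fin-injective⇒surjective (to ∘ f) (f-injective ∘ to-injective) (to y)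
  f⁻¹ : X → Fin k
  f⁻¹ = proj₁ ∘ preimage
  f∘f⁻¹ : ∀ y → f (f⁻¹ y) ≡ y
  f∘f⁻¹ = to-injective ∘ proj₂ ∘ preimage

-- Circulant graphs

CayleyLabelling : (G : Graph) {N : ℕ} → V G ↔ Fin N → (Fin N → Set) → Set
CayleyLabelling G f S = ∀ u v → Adj G u v ⇔ S (subℤ (Inverse.to f v) (Inverse.to f u))

module _ (G : Graph) {N : ℕ} (f : V G ↔ Fin N) (S : Fin N → Set) (cayley : CayleyLabelling G f S) where
  open Inverse f using (to; from; strictlyInverseˡ)

  cayley-adjacent : ∀ i j → Adj G (from i) (from j) ⇔ S (subℤ j i)
  cayley-adjacent i j = subst₂ (λ a b → Adj G (from i) (from j) ⇔ S (subℤ b a))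
    (strictlyInverseˡ i) (strictlyInverseˡ j) (cayley (from i) (from j))

  -- The symmetry S = - S is forced by the symmetry of adjacency, applied to d and 0 = d - d.
  cayley⇒circulant : IsCirculant G
  cayley⇒circulant = N , f , S , S-symmetric , cayley
    where
    S-symmetric : ∀ d → S d → S (negℤ d)
    S-symmetric d =
      subst S (subℤ-self-subℤ d) ∘ Equivalence.to (cayley-adjacent d (subℤ d d)) ∘ Graph.sym G ∘
      Equivalence.from (cayley-adjacent (subℤ d d) d) ∘ subst S (≡.sym (subℤ-subℤ-self d))

empty⇒circulant : (G : Graph) → (V G → ⊥) → IsCirculant G
empty⇒circulant G empty = cayley⇒circulant G labelling (λ _ → ⊥) (⊥-elim ∘ empty)
  where
  labelling : V G ↔ Fin 0
  labelling = mk↔ₛ′ (⊥-elim ∘ empty) (λ ()) (λ ()) (⊥-elim ∘ empty)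

module _ {G : Graph} where

  parity : ∀ {u v} → Walk G u v → Bool
  parity []      = false
  parity (_ ∷ w) = not (parity w)

  colour-along-walk : (c : V G → Bool) → (∀ {u v} → Adj G u v → c u ≢ c v) →
                      ∀ {u v} (w : Walk G u v) → c v ≡ c u xor parity w
  colour-along-walk c proper {u} []        = ≡.sym (xor-identityʳ (c u))
  colour-along-walk c proper {u} (u~v ∷ w) = begin
    c _                       ≡⟨ colour-along-walk c proper w ⟩
    c _ xor parity w          ≡⟨ cong (_xor parity w) (¬-not (proper u~v ∘ ≡.sym)) ⟩
    not (c u) xor parity w    ≡⟨ not-distribˡ-xor (c u) (parity w) ⟨
    not (c u xor parity w)    ≡⟨ not-distribʳ-xor (c u) (parity w) ⟩
    c u xor not (parity w)    ∎
    where open ≡-Reasoning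

module _ {G H : Graph} (φ : V G → V H) (φ-adjacent : ∀ {u v} → Adj G u v → Adj H (φ u) (φ v)) where

  mapWalk : ∀ {u v} → Walk G u v → Walk H (φ u) (φ v)
  mapWalk []        = []
  mapWalk (u~v ∷ w) = φ-adjacent u~v ∷ mapWalk w

  parity-mapWalk : ∀ {u v} (w : Walk G u v) → parity (mapWalk w) ≡ parity w
  parity-mapWalk []      = refl
  parity-mapWalk (_ ∷ w) = cong not (parity-mapWalk w)

module _ (G : Graph) {N : ℕ} .{{_ : NonZero N}} (f : V G ↔ Fin N) (S : Fin N → Set)
         (cayley : CayleyLabelling G f S) where
  open Inverse f using (to; from; strictlyInverseˡ)

  translate-adjacent : ∀ t {u v} → Adj G u v →
                       Adj G (from (translate t (to u))) (from (translate t (to v)))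
  translate-adjacent t {u} {v} =
    Equivalence.from (cayley-adjacent G f S cayley _ _) ∘
    subst S (≡.sym (subℤ-translate t (to u) (to v))) ∘ Equivalence.to (cayley u v)

  module _ (connected : Connected G) (c : V G → Bool)
           (proper : ∀ {u v} → Adj G u v → c u ≢ c v) where

    unit-step-parity : Bool
    unit-step-parity = parity (connected (from (0 mod N)) (from (translate 1 (0 mod N))))

    colour-translate-1 : ∀ i → c (from (translate 1 i)) ≡ c (from i) xor unit-step-parity
    colour-translate-1 i = begin
      c (from (translate 1 i))                          ≡⟨ cong (c ∘ from) shift-one ⟨
      c (σ (from (translate 1 (0 mod N))))              ≡⟨ colour-along-walk c proper shifted ⟩
      c (σ (from (0 mod N))) xor parity shifted
        ≡⟨ cong₂ _xor_ (cong (c ∘ from) shift-origin) (parity-mapWalk σ (translate-adjacent (toℕ i)) walk) ⟩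
      c (from i) xor unit-step-parity                   ∎
      where
      open ≡-Reasoning
      walk : Walk G (from (0 mod N)) (from (translate 1 (0 mod N)))
      walk = connected _ _
      σ : V G → V G
      σ = from ∘ translate (toℕ i) ∘ to
      shifted : Walk G (σ (from (0 mod N))) (σ (from (translate 1 (0 mod N))))
      shifted = mapWalk σ (translate-adjacent (toℕ i)) walk
      shift-origin : translate (toℕ i) (to (from (0 mod N))) ≡ i
      shift-origin = trans (cong (translate (toℕ i)) (strictlyInverseˡ (0 mod N))) (translate-origin i)
      shift-one : translate (toℕ i) (to (from (translate 1 (0 mod N)))) ≡ translate 1 i
      shift-one = trans (cong (translate (toℕ i)) (strictlyInverseˡ (translate 1 (0 mod N))))
                  (trans (translate-comm (toℕ i) 1 (0 mod N)) (cong (translate 1) (translate-origin i)))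

    colour-translate-even : ∀ j i → c (from (translate (2 * j) i)) ≡ c (from i)
    colour-translate-even zero    i =
      cong (c ∘ from) (translate-≡ 0 (≡mod-reflexive (ℤ.+-identityʳ (toℤ i))))
    colour-translate-even (suc j) i = begin
      colour (translate (2 * suc j) i)          ≡⟨ cong (λ t → colour (translate t i)) 2[1+j]≡2j+2 ⟩
      colour (translate (2 * j ℕ.+ 2) i)        ≡⟨ cong colour (translate-+ 2 (2 * j) i) ⟨
      colour (translate 2 k)                    ≡⟨ cong colour (translate-+ 1 1 k) ⟨
      colour (translate 1 (translate 1 k))      ≡⟨ colour-translate-1 (translate 1 k) ⟩
      colour (translate 1 k) xor p              ≡⟨ cong (_xor p) (colour-translate-1 k) ⟩
      (colour k xor p) xor p                    ≡⟨ xor-assoc (colour k) p p ⟩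
      colour k xor (p xor p)                    ≡⟨ cong (colour k xor_) (xor-same p) ⟩
      colour k xor false                        ≡⟨ xor-identityʳ (colour k) ⟩
      colour k                                  ≡⟨ colour-translate-even j i ⟩
      colour i                                  ∎
      where
      open ≡-Reasoning
      colour : Fin N → Bool
      colour = c ∘ from
      p : Bool
      p = unit-step-parity
      k : Fin N
      k = translate (2 * j) i
      2[1+j]≡2j+2 : 2 * suc j ≡ 2 * j ℕ.+ 2
      2[1+j]≡2j+2 = trans (ℕ.*-suc 2 j) (ℕ.+-comm 2 (2 * j))

  connected-bipartite⇒odd : Connected G → Bipartite G → OddConnectionSet S
  connected-bipartite⇒odd connected (c , proper) s Ss with even-or-odd (toℕ s)
  ... | inj₂ s-odd      = s-odd
  ... | inj₁ (j , s≡2j) = contradiction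
    (subst (λ k → c (from (translate k (0 mod N))) ≡ c (from (0 mod N))) (≡.sym s≡2j)
           (colour-translate-even connected c proper j (0 mod N)))
    (proper 0~s ∘ ≡.sym)
    where
    0~s : Adj G (from (0 mod N)) (from (translate (toℕ s) (0 mod N)))
    0~s = Equivalence.from (cayley-adjacent G f S cayley _ _)
            (subst S (≡.sym (subℤ-translate-self s (0 mod N))) Ss)

odd-difference : ∀ {N} {S : Fin N → Set} → 2 ℕ.∣ N → OddConnectionSet S →
                 ∀ {a a'} → S (subℤ a' a) → toℤ a' - toℤ a ≡ + 1 [mod 2 ]
odd-difference 2∣N S-odd {a} {a'} s =
  ≡mod-trans (≡mod-sym (≡mod-∣ 2∣N (toℤ-subℤ a' a))) (S-odd _ s)

-- ℤ_{4nm} as ℤ_{2n} × ℤ_{2m}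

module Interleaving (n m : ℕ) .{{_ : NonZero n}} .{{_ : NonZero m}} (gcd[n,m]≡1 : gcd n m ≡ 1) where

  A B L K : ℕ
  A = 2 * n
  B = 2 * m
  L = n * B
  K = A * B

  instance
    A≢0 : NonZero A
    A≢0 = ℕ.m*n≢0 2 n
    B≢0 : NonZero B
    B≢0 = ℕ.m*n≢0 2 m

  K≡2*L : K ≡ 2 * L
  K≡2*L = reassociate n m
    where
    reassociate : ∀ n m → (2 * n) * (2 * m) ≡ 2 * (n * (2 * m))
    reassociate = ℕ-Solver.solve-∀

  A∣L : A ℕ.∣ L
  A∣L = divides m (reassociate n m)
    where
    reassociate : ∀ n m → n * (2 * m) ≡ m * (2 * n)
    reassociate = ℕ-Solver.solve-∀

  B∣L : B ℕ.∣ L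
  B∣L = divides n refl

  2∣A : 2 ℕ.∣ A
  2∣A = divides n (ℕ.*-comm 2 n)

  2∣B : 2 ℕ.∣ B
  2∣B = divides m (ℕ.*-comm 2 m)

  2∣K : 2 ℕ.∣ K
  2∣K = ℕ.∣-trans 2∣A (divides B (ℕ.*-comm A B))

  lcm[A,B]≡L : lcm A B ≡ L
  lcm[A,B]≡L = ℕ.*-cancelˡ-≡ (lcm A B) L 2 (begin
    2 * lcm A B             ≡⟨ cong (_* lcm A B) gcd[A,B]≡2 ⟨
    gcd A B * lcm A B       ≡⟨ gcd*lcm A B ⟩
    K                       ≡⟨ K≡2*L ⟩
    2 * L                   ∎)
    where
    open ≡-Reasoning
    gcd[A,B]≡2 : gcd A B ≡ 2
    gcd[A,B]≡2 = trans (≡.sym (c*gcd[m,n]≡gcd[cm,cn] 2 n m)) (cong (2 *_) gcd[n,m]≡1)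

  bit half : Fin K → ℕ
  bit x  = toℕ x % 2
  half x = toℕ x / 2

  bit<2 : ∀ x → bit x < 2
  bit<2 x = m%n<n (toℕ x) 2

  half<L : ∀ x → half x < L
  half<L x = m<n*o⇒m/o<n (subst (toℕ x <_) (trans K≡2*L (ℕ.*-comm 2 L)) (Fin.toℕ<n x))

  bit-≡ : ∀ x x' → + bit x ≡ + bit x' [mod 2 ] → bit x ≡ bit x'
  bit-≡ x x' = ≡mod⇒≡ (bit<2 x) (bit<2 x')

  toℤ-bit-half : ∀ x → toℤ x ≡ + bit x + + 2 ℤ.* + half x
  toℤ-bit-half x = begin
    + toℕ x                        ≡⟨ cong +_ (m≡m%n+[m/n]*n (toℕ x) 2) ⟩
    + (bit x ℕ.+ half x * 2)       ≡⟨ ℤ.pos-+ (bit x) (half x * 2) ⟩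
    + bit x + + (half x * 2)       ≡⟨ cong (λ t → + bit x + t) (ℤ.pos-* (half x) 2) ⟩
    + bit x + + half x ℤ.* + 2     ≡⟨ cong (λ t → + bit x + t) (ℤ.*-comm (+ half x) (+ 2)) ⟩
    + bit x + + 2 ℤ.* + half x     ∎
    where open ≡-Reasoning

  toℤ≡bit : ∀ x → toℤ x ≡ + bit x [mod 2 ]
  toℤ≡bit x = begin
    toℤ x                          ≡⟨ toℤ-bit-half x ⟩
    + bit x + + 2 ℤ.* + half x     ≡⟨ cong (λ t → + bit x + t) (ℤ.*-comm (+ 2) (+ half x)) ⟩
    + bit x + + half x ℤ.* + 2     ≈⟨ ≡mod-multiple (+ half x) ⟩
    + bit x                        ∎
    where open ≡mod-Reasoning 2

  -- x = bit x + 2 · half x  goes to  half x · (1, 1) + bit x · (0, 1).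
  ψ : Fin K → Fin A × Fin B
  ψ x = half x mod A , (half x ℕ.+ bit x) mod B

  toℤ-ψ₁ : ∀ x → toℤ (proj₁ (ψ x)) ≡ + half x [mod A ]
  toℤ-ψ₁ x = toℤ-mod A (half x)

  toℤ-ψ₂ : ∀ x → toℤ (proj₂ (ψ x)) ≡ + half x + + bit x [mod B ]
  toℤ-ψ₂ x =
    ≡mod-trans (toℤ-mod B (half x ℕ.+ bit x)) (≡mod-reflexive (ℤ.pos-+ (half x) (bit x)))

  ψ-injective : Injective _≡_ _≡_ ψ
  ψ-injective {x} {x'} ψx≡ψx' = Fin.toℕ-injective (ℤ.+-injective (begin
    toℤ x                             ≡⟨ toℤ-bit-half x ⟩
    + bit x + + 2 ℤ.* + half x        ≡⟨ cong₂ (λ b h → + b + + 2 ℤ.* + h) bits halves ⟩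
    + bit x' + + 2 ℤ.* + half x'      ≡⟨ toℤ-bit-half x' ⟨
    toℤ x'                            ∎))
    where
    open ≡-Reasoning
    halves-A : + half x ≡ + half x' [mod A ]
    halves-A = ≡mod-trans (≡mod-sym (toℤ-ψ₁ x))
      (≡mod-trans (≡mod-reflexive (cong (toℤ ∘ proj₁) ψx≡ψx')) (toℤ-ψ₁ x'))
    sums-B : + half x + + bit x ≡ + half x' + + bit x' [mod B ]
    sums-B = ≡mod-trans (≡mod-sym (toℤ-ψ₂ x))
      (≡mod-trans (≡mod-reflexive (cong (toℤ ∘ proj₂) ψx≡ψx')) (toℤ-ψ₂ x'))
    bits : bit x ≡ bit x'
    bits = bit-≡ x x' (≡mod-+-cancelˡ (≡mod-∣ 2∣B sums-B) (≡mod-∣ 2∣A halves-A))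
    halves : half x ≡ half x'
    halves = ≡mod⇒≡ (half<L x) (half<L x') (subst (λ M → + half x ≡ + half x' [mod M ]) lcm[A,B]≡L
      (≡mod-lcm halves-A (≡mod-+-cancelʳ sums-B (≡mod-reflexive (cong +_ bits)))))

  ψ↔ : Fin K ↔ (Fin A × Fin B)
  ψ↔ = injective⇒↔ ψ ψ-injective (↔-sym Fin.*↔×)

  toℤ-subℤ-mod2 : ∀ x x' → toℤ (subℤ x' x) ≡ + bit x' - + bit x [mod 2 ]
  toℤ-subℤ-mod2 x x' =
    ≡mod-trans (≡mod-∣ 2∣K (toℤ-subℤ x' x)) (≡mod-- (toℤ≡bit x') (toℤ≡bit x))

  same-bit⇒even : ∀ x x' → bit x ≡ bit x' → ∃ λ h → toℕ (subℤ x' x) ≡ 2 * h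
  same-bit⇒even x x' bits with even-or-odd (toℕ (subℤ x' x))
  ... | inj₁ even = even
  ... | inj₂ odd  = contradiction (≡mod⇒≡ (ℕ.n<1+n 1) ℕ.z<s 1≡0) λ ()
    where
    open ≡mod-Reasoning 2
    1≡0 : + 1 ≡ + 0 [mod 2 ]
    1≡0 = begin
      + 1                   ≈⟨ odd ⟨
      toℤ (subℤ x' x)       ≈⟨ toℤ-subℤ-mod2 x x' ⟩
      + bit x' - + bit x    ≡⟨ cong (λ b → + b - + bit x) bits ⟨
      + bit x - + bit x     ≡⟨ ℤ.+-inverseʳ (+ bit x) ⟩
      + 0                   ∎

  even⇒same-bit : ∀ x x' {h} → toℕ (subℤ x' x) ≡ 2 * h → bit x ≡ bit x'
  even⇒same-bit x x' {h} d≡2h = ≡.sym (bit-≡ x' x (≡mod-from-difference (begin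
    + bit x' - + bit x     ≈⟨ toℤ-subℤ-mod2 x x' ⟨
    toℤ (subℤ x' x)        ≡⟨ cong +_ d≡2h ⟩
    + (2 * h)              ≡⟨ trans (ℤ.pos-* 2 h) (ℤ.*-comm (+ 2) (+ h)) ⟩
    + h ℤ.* + 2            ≈⟨ multiple≡mod0 (+ h) ⟩
    + 0                    ∎)))
    where open ≡mod-Reasoning 2

  same-bit⇒components : ∀ x x' {h} → bit x ≡ bit x' → toℕ (subℤ x' x) ≡ 2 * h →
    h mod A ≡ subℤ (proj₁ (ψ x')) (proj₁ (ψ x)) ×
    h mod B ≡ subℤ (proj₂ (ψ x')) (proj₂ (ψ x))
  same-bit⇒components x x' {h} bits d≡2h = toℤ-injective component-A , toℤ-injective component-B
    where
    Δ : ℤ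
    Δ = + half x' - + half x

    h≡Δ : + h ≡ Δ [mod L ]
    h≡Δ = ≡mod-*-cancelˡ 2 (subst (λ M → + 2 ℤ.* + h ≡ + 2 ℤ.* Δ [mod M ]) K≡2*L (begin
      + 2 ℤ.* + h
        ≡⟨ trans (cong +_ d≡2h) (ℤ.pos-* 2 h) ⟨
      toℤ (subℤ x' x)
        ≈⟨ toℤ-subℤ x' x ⟩
      toℤ x' - toℤ x
        ≡⟨ cong₂ _-_ (toℤ-bit-half x') (toℤ-bit-half x) ⟩
      (+ bit x' + + 2 ℤ.* + half x') - (+ bit x + + 2 ℤ.* + half x)
        ≡⟨ cong (λ b → (+ b + + 2 ℤ.* + half x') - (+ bit x + + 2 ℤ.* + half x)) bits ⟨
      (+ bit x + + 2 ℤ.* + half x') - (+ bit x + + 2 ℤ.* + half x)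
        ≡⟨ cancel-bit (+ bit x) (+ half x') (+ half x) ⟩
      + 2 ℤ.* Δ
        ∎))
      where
      open ≡mod-Reasoning K
      cancel-bit : ∀ b y' y → (b + + 2 ℤ.* y') - (b + + 2 ℤ.* y) ≡ + 2 ℤ.* (y' - y)
      cancel-bit = solve-∀

    component-A : toℤ (h mod A) ≡ toℤ (subℤ (proj₁ (ψ x')) (proj₁ (ψ x))) [mod A ]
    component-A = begin
      toℤ (h mod A)                                ≈⟨ toℤ-mod A h ⟩
      + h                                          ≈⟨ ≡mod-∣ A∣L h≡Δ ⟩
      Δ                                            ≈⟨ ≡mod-- (toℤ-ψ₁ x') (toℤ-ψ₁ x) ⟨
      toℤ (proj₁ (ψ x')) - toℤ (proj₁ (ψ x))       ≈⟨ toℤ-subℤ _ _ ⟨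
      toℤ (subℤ (proj₁ (ψ x')) (proj₁ (ψ x)))      ∎
      where open ≡mod-Reasoning A

    component-B : toℤ (h mod B) ≡ toℤ (subℤ (proj₂ (ψ x')) (proj₂ (ψ x))) [mod B ]
    component-B = begin
      toℤ (h mod B)                                  ≈⟨ toℤ-mod B h ⟩
      + h                                            ≈⟨ ≡mod-∣ B∣L h≡Δ ⟩
      Δ                                              ≡⟨ shift (+ half x') (+ half x) (+ bit x) ⟩
      (+ half x' + + bit x) - (+ half x + + bit x)
        ≡⟨ cong (λ b → (+ half x' + + b) - (+ half x + + bit x)) bits ⟩
      (+ half x' + + bit x') - (+ half x + + bit x)  ≈⟨ ≡mod-- (toℤ-ψ₂ x') (toℤ-ψ₂ x) ⟨
      toℤ (proj₂ (ψ x')) - toℤ (proj₂ (ψ x))         ≈⟨ toℤ-subℤ _ _ ⟨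
      toℤ (subℤ (proj₂ (ψ x')) (proj₂ (ψ x)))        ∎
      where
      open ≡mod-Reasoning B
      shift : ∀ a b c → a - b ≡ (a + c) - (b + c)
      shift = solve-∀

  odd-components⇒same-bit : ∀ x x' →
    toℤ (proj₁ (ψ x')) - toℤ (proj₁ (ψ x)) ≡ + 1 [mod 2 ] →
    toℤ (proj₂ (ψ x')) - toℤ (proj₂ (ψ x)) ≡ + 1 [mod 2 ] → bit x ≡ bit x'
  odd-components⇒same-bit x x' odd₁ odd₂ =
    ≡.sym (bit-≡ x' x (≡mod-from-difference (≡mod-+-cancelˡ Δ+bits≡Δ (≡mod-refl {a = Δ}))))
    where
    open ≡mod-Reasoning 2
    Δ : ℤ
    Δ = + half x' - + half x
    Δ-odd : Δ ≡ + 1 [mod 2 ]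
    Δ-odd = ≡mod-trans (≡mod-sym (≡mod-∣ 2∣A (≡mod-- (toℤ-ψ₁ x') (toℤ-ψ₁ x)))) odd₁
    regroup : ∀ a b c d → (a - b) + (c - d) ≡ (a + c) - (b + d)
    regroup = solve-∀
    Δ+bits≡Δ : Δ + (+ bit x' - + bit x) ≡ Δ + + 0 [mod 2 ]
    Δ+bits≡Δ = begin
      Δ + (+ bit x' - + bit x)
        ≡⟨ regroup (+ half x') (+ half x) (+ bit x') (+ bit x) ⟩
      (+ half x' + + bit x') - (+ half x + + bit x)
        ≈⟨ ≡mod-∣ 2∣B (≡mod-- (toℤ-ψ₂ x') (toℤ-ψ₂ x)) ⟨
      toℤ (proj₂ (ψ x')) - toℤ (proj₂ (ψ x))           ≈⟨ odd₂ ⟩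
      + 1                                              ≈⟨ Δ-odd ⟨
      Δ                                                ≡⟨ ℤ.+-identityʳ Δ ⟨
      Δ + + 0                                          ∎

  module _ (G H : Graph) {S : Fin A → Set} {T : Fin B → Set} (fG : V G ↔ Fin A) (fH : V H ↔ Fin B)
           (S-odd : OddConnectionSet S) (T-odd : OddConnectionSet T)
           (cayleyG : CayleyLabelling G fG S) (cayleyH : CayleyLabelling H fH T) where

    U : Fin K → Set
    U d = ∃ λ h → toℕ d ≡ 2 * h × S (h mod A) × T (h mod B)

    Related : Fin A × Fin B → Fin A × Fin B → Set
    Related (a , b) (a' , b') = S (subℤ a' a) × T (subℤ b' b)

    related⇒same-bit : ∀ x x' → Related (ψ x) (ψ x') → bit x ≡ bit x'
    related⇒same-bit x x' (s , t) =
      odd-components⇒same-bit x x' (odd-difference 2∣A S-odd s) (odd-difference 2∣B T-odd t)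

    related⇔halves : ∀ x x' {h} → bit x ≡ bit x' → toℕ (subℤ x' x) ≡ 2 * h →
                     Related (ψ x) (ψ x') ⇔ (S (h mod A) × T (h mod B))
    related⇔halves x x' {h} bits d≡2h = mk⇔
      (λ (s , t) → subst S (≡.sym h≡Δ₁) s , subst T (≡.sym h≡Δ₂) t)
      (λ (s , t) → subst S h≡Δ₁ s , subst T h≡Δ₂ t)
      where
      h≡Δ₁ : h mod A ≡ subℤ (proj₁ (ψ x')) (proj₁ (ψ x))
      h≡Δ₁ = proj₁ (same-bit⇒components x x' bits d≡2h)
      h≡Δ₂ : h mod B ≡ subℤ (proj₂ (ψ x')) (proj₂ (ψ x))
      h≡Δ₂ = proj₂ (same-bit⇒components x x' bits d≡2h)

    related⇔U : ∀ x x' → Related (ψ x) (ψ x') ⇔ U (subℤ x' x)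
    related⇔U x x' = mk⇔ forward backward
      where
      forward : Related (ψ x) (ψ x') → U (subℤ x' x)
      forward r = h , d≡2h , Equivalence.to (related⇔halves x x' bits d≡2h) r
        where
        bits : bit x ≡ bit x'
        bits = related⇒same-bit x x' r
        h : ℕ
        h = proj₁ (same-bit⇒even x x' bits)
        d≡2h : toℕ (subℤ x' x) ≡ 2 * h
        d≡2h = proj₂ (same-bit⇒even x x' bits)
      backward : U (subℤ x' x) → Related (ψ x) (ψ x')
      backward (h , d≡2h , st) =
        Equivalence.from (related⇔halves x x' (even⇒same-bit x x' {h} d≡2h) d≡2h) st

    labelling : (V G × V H) ↔ Fin K
    labelling = ↔-sym ψ↔ ↔-∘ (fG ×-↔ fH)

    product-cayley : CayleyLabelling (G ⊗ H) labelling U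
    product-cayley (u , v) (u' , v') =
      subst₂ (λ p p' → Related p p' ⇔ U (subℤ x' x)) (ψ∘ψ⁻¹ p) (ψ∘ψ⁻¹ p') (related⇔U x x')
        ⇔-∘ (cayleyG u u' ×-⇔ cayleyH v v')
      where
      ψ∘ψ⁻¹ : ∀ q → ψ (Inverse.from ψ↔ q) ≡ q
      ψ∘ψ⁻¹ = Inverse.strictlyInverseˡ ψ↔
      p p' : Fin A × Fin B
      p  = Inverse.to fG u  , Inverse.to fH v
      p' = Inverse.to fG u' , Inverse.to fH v'
      x x' : Fin K
      x  = Inverse.from ψ↔ p
      x' = Inverse.from ψ↔ p'

    product-circulant : IsCirculant (G ⊗ H)
    product-circulant = cayley⇒circulant (G ⊗ H) labelling U product-cayley

theorem10 : (G H : Graph) (n m : ℕ) →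
    HasOrder G (2 * n) → HasOrder H (2 * m) →
    Connected G → Connected H →
    IsCirculant G → IsCirculant H →
    Bipartite G → Bipartite H →
    gcd n m ≡ 1 →
    IsCirculant (G ⊗ H)
theorem10 G H zero m |G| _ _ _ _ _ _ _ _ =
  empty⇒circulant (G ⊗ H) (Fin.¬Fin0 ∘ Inverse.to |G| ∘ proj₁)
theorem10 G H (suc _) zero _ |H| _ _ _ _ _ _ _ =
  empty⇒circulant (G ⊗ H) (Fin.¬Fin0 ∘ Inverse.to |H| ∘ proj₂)
theorem10 G H n@(suc _) m@(suc _) |G| |H| connectedG connectedH
          (_ , fG , S , _ , cayleyG) (_ , fH , T , _ , cayleyH) bipartiteG bipartiteH gcd[n,m]≡1
  with refl ← ↔⇒≡ (|G| ↔-∘ ↔-sym fG) | refl ← ↔⇒≡ (|H| ↔-∘ ↔-sym fH) =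
  product-circulant G H fG fH
    (connected-bipartite⇒odd G fG S cayleyG connectedG bipartiteG)
    (connected-bipartite⇒odd H fH T cayleyH connectedH bipartiteH)
    cayleyG cayleyH
  where open Interleaving n m gcd[n,m]≡1
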